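{- Let $D$ be a unique factorization domain and let $a,b$ be elements algebraic over $D$ such that $(a+b)^2$ and $ab$ are coprime elements of $D$. Let $m, n$ be positive coprime integers which are both odd. Then $P_m(a,b)$ and $P_n(a,b)$ (which lie in $D$) are coprime in $D$.
   Context: For $n \ge 1$, $P_n(X,Y) = \frac{X^n - Y^n}{X-Y} = \sum_{k=0}^{n-1}X^{n-1-k}Y^k \in \mathbb{Z}[X,Y]$. Coprime means having no common prime divisor in $D$. -}

module Defs where

open import Level using (Level; _⊔_)
open import Algebra.Bundles using (CommutativeRing)
open import Data.Nat using (ℕ; zero; suc; _∸_)
import Data.Nat as ℕ
open import Data.List using (List; []; _∷_; foldr)
open import Data.List.Relation.Unary.All using (All)
open import Data.List.Relation.Unary.Any using (Any)
open import Data.Product using (Σ; ∃; _×_)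
open import Data.Sum using (_⊎_)
open import Relation.Nullary using (¬_)
import Algebra.Morphism.Structures as MS

module _ {c ℓ : Level} (R : CommutativeRing c ℓ) where
  open CommutativeRing R

  Divides : Carrier → Carrier → Set (c ⊔ ℓ)
  Divides x y = Σ Carrier λ z → y ≈ x * z

  IsUnit : Carrier → Set (c ⊔ ℓ)
  IsUnit x = Σ Carrier λ y → x * y ≈ 1#

  IsIntegralDomain : Set (c ⊔ ℓ)
  IsIntegralDomain = (¬ (1# ≈ 0#)) × (∀ x y → x * y ≈ 0# → (x ≈ 0#) ⊎ (y ≈ 0#))

  IsIrreducible : Carrier → Set (c ⊔ ℓ)
  IsIrreducible p = (¬ (p ≈ 0#)) × (¬ IsUnit p) ×
                    (∀ x y → p ≈ x * y → IsUnit x ⊎ IsUnit y)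

  IsPrime : Carrier → Set (c ⊔ ℓ)
  IsPrime p = (¬ (p ≈ 0#)) × (¬ IsUnit p) ×
              (∀ x y → Divides p (x * y) → Divides p x ⊎ Divides p y)

  listProd : List Carrier → Carrier
  listProd = foldr _*_ 1#

  -- Unique factorization domain: an integral domain in which every nonzero
  -- nonunit is a finite product of irreducibles, and every irreducible is prime
  -- (equivalent to uniqueness of factorizations up to order and associates).
  IsUFD : Set (c ⊔ ℓ)
  IsUFD = IsIntegralDomain ×
          (∀ x → ¬ (x ≈ 0#) → ¬ IsUnit x →
             Σ (List Carrier) λ ps → All IsIrreducible ps × (x ≈ listProd ps)) ×
          (∀ p → IsIrreducible p → IsPrime p)

  CoprimeIn : Carrier → Carrier → Set (c ⊔ ℓ)
  CoprimeIn x y = ∀ p → IsPrime p → Divides p x → Divides p y → Data.Empty.⊥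
    where import Data.Empty

  pow : Carrier → ℕ → Carrier
  pow x zero = 1#
  pow x (suc k) = pow x k * x

  Psum : ℕ → ℕ → Carrier → Carrier → Carrier
  Psum n zero x y = 0#
  Psum n (suc k) x y = Psum n k x y + pow x (n ∸ suc k) * pow y k

  P : ℕ → Carrier → Carrier → Carrier
  P n x y = Psum n n x y

module _ {c ℓ c' ℓ' : Level} (D : CommutativeRing c ℓ) (R : CommutativeRing c' ℓ')
         (ι : CommutativeRing.Carrier D → CommutativeRing.Carrier R) where
  private
    module D = CommutativeRing D
    module R = CommutativeRing R

  -- polynomial with coefficients in D (lowest degree first), evaluated in R via ι
  evalPoly : List D.Carrier → R.Carrier → R.Carrier
  evalPoly [] x = R.0#
  evalPoly (c₀ ∷ cs) x = ι c₀ R.+ x R.* evalPoly cs x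

  IsAlgebraicOver : R.Carrier → Set (c ⊔ ℓ ⊔ ℓ')
  IsAlgebraicOver x = Σ (List D.Carrier) λ cs →
    Any (λ d → ¬ (d D.≈ D.0#)) cs × (evalPoly cs x R.≈ R.0#)

IsRingMonomorphism : {c ℓ c' ℓ' : Level} (D : CommutativeRing c ℓ) (R : CommutativeRing c' ℓ') →
  (CommutativeRing.Carrier D → CommutativeRing.Carrier R) → Set (c ⊔ ℓ ⊔ ℓ')
IsRingMonomorphism D R ι =
  MS.RingMorphisms.IsRingMonomorphism (CommutativeRing.rawRing D) (CommutativeRing.rawRing R) ι

Odd : ℕ → Set
Odd m = ∃ λ k → m ≡ suc (2 ℕ.* k)
  where open import Relation.Binary.PropositionalEquality using (_≡_)

{-# OPTIONS --safe #-}
-- With s = a + b and t = ab, P_k(a,b) is the Lucas sequence U_k(s,t), U_{k+2} = s U_{k+1} - t U_k.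
-- In D there is a sequence W_{k+2} = h_{k+1} W_{k+1} - v W_k with h = u, 1, u, 1, …, where
-- u = s² and v = t, such that U_k = s W_k for even k and U_k = W_k for odd k.
-- A prime p of D dividing W_m with m odd divides u iff it divides v, so (u, v coprime) it divides
-- neither; then it never divides two consecutive terms. The addition formula
-- U_{r+n+1} + t U_r U_n = U_{r+1} U_{n+1}, rescaled into the image of D, lets p run Euclid's
-- algorithm from W_m, W_n down to W_1 = 1.
module Submission where

open import Defs
open import Level using (Level)
open import Algebra.Bundles using (CommutativeRing)
open import Data.Nat using (ℕ; zero; suc; _≥_; _<_; s≤s; z<s)
import Data.Nat as ℕ
open import Data.Nat.Properties
  using (≤-total; m∸n+n≡m; m+[n∸m]≡n; m<m+n; m<n+m; *-suc; +-suc; +-∸-assoc; n∸n≡0; ≤-refl; ≤-trans; n≤1+n)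
open import Data.Nat.Coprimality using (Coprime; 0-coprimeTo-m⇒m≡1)
import Data.Nat.Coprimality as Coprimality
open import Data.Nat.Divisibility using (∣m∣n⇒∣m+n)
open import Data.Nat.Induction using (<-wellFounded)
open import Induction.WellFounded using (Acc; acc)
open import Data.Product using (Σ; _×_; _,_; proj₁; proj₂)
open import Data.Sum using (_⊎_; inj₁; inj₂)
open import Data.Empty using (⊥-elim)
open import Relation.Nullary using (¬_)
open import Relation.Binary.PropositionalEquality using (_≡_)
import Relation.Binary.PropositionalEquality as ≡
import Algebra.Morphism.Structures as MS

module CoprimeDescent {q} (Q : ℕ → Set q)
  (Q-∸ : ∀ r n → Q (r ℕ.+ suc n) → Q (suc n) → Q r) where
  open import Data.Nat using (_+_; _∸_)

  coprime-cancel-+ : ∀ {m r} → Coprime m (r + m) → Coprime m r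
  coprime-cancel-+ cop (d∣m , d∣r) = cop (d∣m , ∣m∣n⇒∣m+n d∣r d∣m)

  coprime-descent : ∀ {m n} → Acc _<_ (m + n) → Coprime m n → Q m → Q n → Q 1
  coprime-descent {zero} _ cop _ qn = ≡.subst Q (0-coprimeTo-m⇒m≡1 cop) qn
  coprime-descent {suc m} {zero} _ cop qm _ =
    ≡.subst Q (0-coprimeTo-m⇒m≡1 (Coprimality.sym cop)) qm
  coprime-descent {suc m} {suc n} (acc rec) cop qm qn with ≤-total m n
  ... | inj₁ m≤n =
    coprime-descent (rec smaller) (coprime-cancel-+ (≡.subst (Coprime (suc m)) split cop))
      qm (Q-∸ (n ∸ m) m (≡.subst Q split qn) qm)
    where
    split : suc n ≡ (n ∸ m) + suc m
    split = ≡.sym (m∸n+n≡m (s≤s m≤n))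
    smaller : suc m + (n ∸ m) < suc m + suc n
    smaller = ≡.subst (_< suc m + suc n) (≡.cong suc (≡.sym (m+[n∸m]≡n m≤n))) (m<n+m (suc n) z<s)
  ... | inj₂ n≤m =
    coprime-descent (rec smaller)
      (Coprimality.sym (coprime-cancel-+ (≡.subst (Coprime (suc n)) split (Coprimality.sym cop))))
      (Q-∸ (m ∸ n) n (≡.subst Q split qm) qn) qn
    where
    split : suc m ≡ (m ∸ n) + suc n
    split = ≡.sym (m∸n+n≡m (s≤s n≤m))
    smaller : (m ∸ n) + suc n < suc m + suc n
    smaller = ≡.subst (_< suc m + suc n) split (m<m+n (suc m) z<s)

  coprime⇒Q1 : ∀ {m n} → Coprime m n → Q m → Q n → Q 1
  coprime⇒Q1 = coprime-descent (<-wellFounded _)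

module _ {a} {A : Set a} where

  alternate : A → A → ℕ → A
  alternate x y zero = x
  alternate x y (suc zero) = y
  alternate x y (suc (suc k)) = alternate x y k

  alternate-even : ∀ {x y} k → alternate x y (2 ℕ.* k) ≡ x
  alternate-even zero = ≡.refl
  alternate-even {x} {y} (suc k) =
    ≡.trans (≡.cong (alternate x y) (*-suc 2 k)) (alternate-even k)

  alternate-odd : ∀ {x y} k → alternate x y (suc (2 ℕ.* k)) ≡ y
  alternate-odd zero = ≡.refl
  alternate-odd {x} {y} (suc k) =
    ≡.trans (≡.cong (λ j → alternate x y (suc j)) (*-suc 2 k)) (alternate-odd k)

  alternate-preserves : ∀ {p} {P : A → Set p} {x y} → P x → P y → ∀ k → P (alternate x y k)
  alternate-preserves px py zero = px
  alternate-preserves px py (suc zero) = py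
  alternate-preserves {P = P} px py (suc (suc k)) = alternate-preserves {P = P} px py k

alternate-pointwise : ∀ {a b r} {A : Set a} {B : Set b} {_~_ : A → B → Set r} {x y x′ y′} →
  x ~ x′ → y ~ y′ → ∀ k → alternate x y k ~ alternate x′ y′ k
alternate-pointwise x~ y~ zero = x~
alternate-pointwise x~ y~ (suc zero) = y~
alternate-pointwise {_~_ = _~_} x~ y~ (suc (suc k)) = alternate-pointwise {_~_ = _~_} x~ y~ k

module Divisibility {c ℓ} (X : CommutativeRing c ℓ) where
  open CommutativeRing X
  open import Algebra.Properties.Ring ring using (-‿distribʳ-*)
  open import Algebra.Properties.AbelianGroup +-abelianGroup using (xyx⁻¹≈y)
  open import Relation.Binary.Reasoning.Setoid setoid

  infix 4 _∣_
  _∣_ : Carrier → Carrier → Set _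
  _∣_ = Divides X

  ∣-respʳ : ∀ {p x y} → x ≈ y → p ∣ x → p ∣ y
  ∣-respʳ x≈y (z , x≈pz) = z , trans (sym x≈y) x≈pz

  x∣y⇒x∣yz : ∀ {p x} y → p ∣ x → p ∣ x * y
  x∣y⇒x∣yz {p} y (z , e) = z * y , trans (*-congʳ e) (*-assoc p z y)

  x∣y⇒x∣zy : ∀ {p y} x → p ∣ y → p ∣ x * y
  x∣y⇒x∣zy {y = y} x d = ∣-respʳ (*-comm y x) (x∣y⇒x∣yz x d)

  x∣y∧x∣z⇒x∣y+z : ∀ {p x y} → p ∣ x → p ∣ y → p ∣ x + y
  x∣y∧x∣z⇒x∣y+z {p} (z₁ , e₁) (z₂ , e₂) = z₁ + z₂ , trans (+-cong e₁ e₂) (sym (distribˡ p z₁ z₂))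

  x∣y+z∧x∣y⇒x∣z : ∀ {p x y} → p ∣ x + y → p ∣ x → p ∣ y
  x∣y+z∧x∣y⇒x∣z {p} {x} {y} (z₁ , e₁) (z₂ , e₂) = z₁ - z₂ , (begin
    y                   ≈⟨ xyx⁻¹≈y x y ⟨
    x + y - x           ≈⟨ +-cong e₁ (-‿cong e₂) ⟩
    p * z₁ - p * z₂     ≈⟨ +-congˡ (-‿distribʳ-* p z₂) ⟩
    p * z₁ + p * - z₂   ≈⟨ distribˡ p z₁ (- z₂) ⟨
    p * (z₁ - z₂)       ∎)

  module Prime {p} (prime : IsPrime X p) where

    prime∤1 : ¬ p ∣ 1#
    prime∤1 (z , 1≈pz) = proj₁ (proj₂ prime) (z , sym 1≈pz)

    prime-split : ∀ {x y} → p ∣ x * y → p ∣ x ⊎ p ∣ y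
    prime-split {x} {y} = proj₂ (proj₂ prime) x y

    ∣xy∧∤y⇒∣x : ∀ {x y} → p ∣ x * y → ¬ p ∣ y → p ∣ x
    ∣xy∧∤y⇒∣x d p∤y with prime-split d
    ... | inj₁ p∣x = p∣x
    ... | inj₂ p∣y = ⊥-elim (p∤y p∣y)

    ∣xy∧∤x⇒∣y : ∀ {x y} → p ∣ x * y → ¬ p ∣ x → p ∣ y
    ∣xy∧∤x⇒∣y {x} {y} d = ∣xy∧∤y⇒∣x (∣-respʳ (*-comm x y) d)

    ∤x∧∤y⇒∤xy : ∀ {x y} → ¬ p ∣ x → ¬ p ∣ y → ¬ p ∣ x * y
    ∤x∧∤y⇒∤xy p∤x p∤y d = p∤x (∣xy∧∤y⇒∣x d p∤y)

module LucasSequence {c ℓ} (X : CommutativeRing c ℓ) (s t : CommutativeRing.Carrier X) where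
  open CommutativeRing X
  open import Algebra.Properties.Group +-group using (//-rightDividesˡ; ∙-cancelʳ)
  open import Relation.Binary.Reasoning.Setoid setoid
  open import Algebra.Solver.Ring.NaturalCoefficients.Default commutativeSemiring

  U : ℕ → Carrier
  U zero = 0#
  U (suc zero) = 1#
  U (suc (suc k)) = s * U (suc k) - t * U k

  U-rec : ∀ k → U (suc (suc k)) + t * U k ≈ s * U (suc k)
  U-rec k = //-rightDividesˡ (t * U k) (s * U (suc k))

  U-rec-unique : ∀ {x} k → x + t * U k ≈ s * U (suc k) → x ≈ U (suc (suc k))
  U-rec-unique k e = ∙-cancelʳ (t * U k) _ _ (trans e (sym (U-rec k)))

  U-+ : ∀ r n → U (r ℕ.+ suc n) + t * U r * U n ≈ U (suc r) * U (suc n)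
  U-+ zero n = solve 3 (λ x t y → x :+ t :* con 0 :* y := con 1 :* x) refl (U (suc n)) t (U n)
  U-+ (suc r) n = ∙-cancelʳ (t * U₀ * Uₙ₁) _ _ (begin
    A + t * U₁ * Uₙ + t * U₀ * Uₙ₁
      ≈⟨ solve 6 (λ A t U₁ Uₙ U₀ Uₙ₁ → A :+ t :* U₁ :* Uₙ :+ t :* U₀ :* Uₙ₁
                                      := A :+ t :* U₀ :* Uₙ₁ :+ t :* U₁ :* Uₙ) refl A t U₁ Uₙ U₀ Uₙ₁ ⟩
    A + t * U₀ * Uₙ₁ + t * U₁ * Uₙ   ≈⟨ +-congʳ IH ⟩
    U₁ * Uₙ₂ + t * U₁ * Uₙ           ≈⟨ solve 4 (λ U₁ Uₙ₂ t Uₙ → U₁ :* Uₙ₂ :+ t :* U₁ :* Uₙ := U₁ :* (Uₙ₂ :+ t :* Uₙ)) refl U₁ Uₙ₂ t Uₙ ⟩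
    U₁ * (Uₙ₂ + t * Uₙ)              ≈⟨ *-congˡ (U-rec n) ⟩
    U₁ * (s * Uₙ₁)                   ≈⟨ solve 3 (λ U₁ s Uₙ₁ → U₁ :* (s :* Uₙ₁) := s :* U₁ :* Uₙ₁) refl U₁ s Uₙ₁ ⟩
    s * U₁ * Uₙ₁                     ≈⟨ *-congʳ (U-rec r) ⟨
    (U₂ + t * U₀) * Uₙ₁              ≈⟨ distribʳ Uₙ₁ U₂ (t * U₀) ⟩
    U₂ * Uₙ₁ + t * U₀ * Uₙ₁          ∎)
    where
    A = U (suc (r ℕ.+ suc n))
    U₀ = U r
    U₁ = U (suc r)
    U₂ = U (suc (suc r))
    Uₙ = U n
    Uₙ₁ = U (suc n)
    Uₙ₂ = U (suc (suc n))
    IH : A + t * U₀ * Uₙ₁ ≈ U₁ * Uₙ₂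
    IH = trans (+-congʳ (reflexive (≡.cong U (≡.sym (+-suc r (suc n)))))) (U-+ r (suc n))

module Homogeneous {c ℓ} (X : CommutativeRing c ℓ) where
  open CommutativeRing X
  open import Relation.Binary.Reasoning.Setoid setoid
  open import Algebra.Solver.Ring.NaturalCoefficients.Default commutativeSemiring
  module _ (x y : Carrier) where
    open LucasSequence X (x + y) (x * y) using (U; U-rec-unique)

    Psum-suc : ∀ n k → k ℕ.≤ n → Psum X (suc n) k x y ≈ x * Psum X n k x y
    Psum-suc n zero _ = sym (zeroʳ x)
    Psum-suc n (suc j) j<n = begin
      Psum X (suc n) j x y + pow X x (n ℕ.∸ j) * pow X y j
        ≈⟨ +-cong (Psum-suc n j (≤-trans (n≤1+n j) j<n))
                  (*-congʳ (reflexive (≡.cong (pow X x) (+-∸-assoc 1 j<n)))) ⟩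
      x * S + xⁱ * x * yʲ  ≈⟨ solve 4 (λ x S xⁱ yʲ → x :* S :+ xⁱ :* x :* yʲ := x :* (S :+ xⁱ :* yʲ)) refl x S xⁱ yʲ ⟩
      x * (S + xⁱ * yʲ)    ∎
      where
      S = Psum X n j x y
      xⁱ = pow X x (n ℕ.∸ suc j)
      yʲ = pow X y j

    P-suc : ∀ n → P X (suc n) x y ≈ x * P X n x y + pow X y n
    P-suc n = +-cong (Psum-suc n n ≤-refl)
      (trans (*-congʳ (reflexive (≡.cong (pow X x) (n∸n≡0 n)))) (*-identityˡ (pow X y n)))

    P-rec : ∀ k → P X (suc (suc k)) x y + x * y * P X k x y ≈ (x + y) * P X (suc k) x y
    P-rec k = begin
      P X (suc (suc k)) x y + x * y * P₀     ≈⟨ +-congʳ (P-suc (suc k)) ⟩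
      x * P₁ + yᵏ * y + x * y * P₀           ≈⟨ solve 5 (λ x y P₁ yᵏ P₀ → x :* P₁ :+ yᵏ :* y :+ x :* y :* P₀
                                                           := x :* P₁ :+ y :* (x :* P₀ :+ yᵏ)) refl x y P₁ yᵏ P₀ ⟩
      x * P₁ + y * (x * P₀ + yᵏ)             ≈⟨ +-congˡ (*-congˡ (P-suc k)) ⟨
      x * P₁ + y * P₁                        ≈⟨ distribʳ P₁ x y ⟨
      (x + y) * P₁                           ∎
      where
      P₀ = P X k x y
      P₁ = P X (suc k) x y
      yᵏ = pow X y k

    P≈U : ∀ k → P X k x y ≈ U k
    P≈U zero = refl
    P≈U (suc zero) = trans (+-identityˡ _) (*-identityˡ 1#)
    P≈U (suc (suc k)) = U-rec-unique k (begin
      P X (suc (suc k)) x y + x * y * U k        ≈⟨ +-congˡ (*-congˡ (P≈U k)) ⟨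
      P X (suc (suc k)) x y + x * y * P X k x y  ≈⟨ P-rec k ⟩
      (x + y) * P X (suc k) x y                  ≈⟨ *-congˡ (P≈U (suc k)) ⟩
      (x + y) * U (suc k)                        ∎)

module ReducedLucas {c ℓ} (D : CommutativeRing c ℓ) (u v : CommutativeRing.Carrier D) where
  open CommutativeRing D
  open import Algebra.Properties.Group +-group using (//-rightDividesˡ)
  open Divisibility D

  h : ℕ → Carrier
  h = alternate u 1#

  W : ℕ → Carrier
  W zero = 0#
  W (suc zero) = 1#
  W (suc (suc k)) = h (suc k) * W (suc k) - v * W k

  W-rec : ∀ k → W (suc (suc k)) + v * W k ≈ h (suc k) * W (suc k)
  W-rec k = //-rightDividesˡ (v * W k) (h (suc k) * W (suc k))

  module PrimeDivisor {p} (prime : IsPrime D p) where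
    open Prime prime

    ∣h⇒∣u : ∀ k → p ∣ h k → p ∣ u
    ∣h⇒∣u = alternate-preserves {P = λ x → p ∣ x → p ∣ u} (λ p∣u → p∣u) (λ p∣1 → ⊥-elim (prime∤1 p∣1))

    ∣W[1+k]∧∣W[k]⇒∣v : ∀ k → p ∣ W (suc k) → p ∣ W k → p ∣ v
    ∣W[1+k]∧∣W[k]⇒∣v zero p∣1 _ = ⊥-elim (prime∤1 p∣1)
    ∣W[1+k]∧∣W[k]⇒∣v (suc k) p∣W₂ p∣W₁
      with prime-split (x∣y+z∧x∣y⇒x∣z (∣-respʳ (sym (W-rec k)) (x∣y⇒x∣zy (h (suc k)) p∣W₁)) p∣W₂)
    ... | inj₁ p∣v = p∣v
    ... | inj₂ p∣W₀ = ∣W[1+k]∧∣W[k]⇒∣v k p∣W₁ p∣W₀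

    ∣v∧∣W[1+k]⇒∣u : ∀ k → p ∣ v → p ∣ W (suc k) → p ∣ u
    ∣v∧∣W[1+k]⇒∣u zero _ p∣1 = ⊥-elim (prime∤1 p∣1)
    ∣v∧∣W[1+k]⇒∣u (suc k) p∣v p∣W₂
      with prime-split (∣-respʳ (W-rec k) (x∣y∧x∣z⇒x∣y+z p∣W₂ (x∣y⇒x∣yz (W k) p∣v)))
    ... | inj₁ p∣h = ∣h⇒∣u (suc k) p∣h
    ... | inj₂ p∣W₁ = ∣v∧∣W[1+k]⇒∣u k p∣v p∣W₁

    ∣u∧∣W[1+2k]⇒∣v : ∀ k → p ∣ u → p ∣ W (suc (2 ℕ.* k)) → p ∣ v
    ∣u∧∣W[1+2k]⇒∣v zero _ p∣1 = ⊥-elim (prime∤1 p∣1)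
    ∣u∧∣W[1+2k]⇒∣v (suc k) p∣u p∣W
      with prime-split (x∣y+z∧x∣y⇒x∣z (∣-respʳ (sym (W-rec j)) (x∣y⇒x∣yz (W (suc j)) p∣h)) p∣W₂)
      where
      j = suc (2 ℕ.* k)
      p∣h : p ∣ h (suc j)
      p∣h = ≡.subst (p ∣_) (≡.sym (alternate-even k)) p∣u
      p∣W₂ : p ∣ W (suc (suc j))
      p∣W₂ = ≡.subst (λ i → p ∣ W (suc i)) (*-suc 2 k) p∣W
    ... | inj₁ p∣v = p∣v
    ... | inj₂ p∣W₀ = ∣u∧∣W[1+2k]⇒∣v k p∣u p∣W₀

module Transfer {c ℓ c′ ℓ′} {D : CommutativeRing c ℓ} {R : CommutativeRing c′ ℓ′}
  {ι : CommutativeRing.Carrier D → CommutativeRing.Carrier R} (mono : IsRingMonomorphism D R ι)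
  {u v : CommutativeRing.Carrier D} {s t : CommutativeRing.Carrier R}
  (ι-u : CommutativeRing._≈_ R (ι u) (CommutativeRing._*_ R s s))
  (ι-v : CommutativeRing._≈_ R (ι v) t) where
  private
    module D = CommutativeRing D
    module M = MS.RingMorphisms.IsRingMonomorphism mono
  open CommutativeRing R
  open import Relation.Binary.Reasoning.Setoid setoid
  open import Algebra.Solver.Ring.NaturalCoefficients.Default commutativeSemiring
  open LucasSequence R s t
  open ReducedLucas D u v
  open Divisibility D

  infix 4 _↦_
  _↦_ : D.Carrier → Carrier → Set ℓ′
  x ↦ r = ι x ≈ r

  ↦-+ : ∀ {x y r r′} → x ↦ r → y ↦ r′ → x D.+ y ↦ r + r′
  ↦-+ {x} {y} e e′ = trans (M.+-homo x y) (+-cong e e′)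

  ↦-* : ∀ {x y r r′} → x ↦ r → y ↦ r′ → x D.* y ↦ r * r′
  ↦-* {x} {y} e e′ = trans (M.*-homo x y) (*-cong e e′)

  ↦-injective : ∀ {x y r} → x ↦ r → y ↦ r → x D.≈ y
  ↦-injective e e′ = M.injective (trans e (sym e′))

  f : ℕ → Carrier
  f = alternate s 1#

  g : ℕ → ℕ → D.Carrier
  g r n = alternate u (h n) r

  ι-h : ∀ k → h k ↦ f k * f k
  ι-h = alternate-pointwise {_~_ = λ x r → x ↦ r * r} ι-u (trans M.1#-homo (sym (*-identityˡ 1#)))

  f-suc : ∀ k → f k * f (suc k) ≈ s
  f-suc zero = *-identityʳ s
  f-suc (suc zero) = *-identityˡ s
  f-suc (suc (suc k)) = f-suc k

  ι-g : ∀ r n → g r n ↦ f r * f n * f (r ℕ.+ suc n)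
  ι-g zero n = begin
    ι u                    ≈⟨ ι-u ⟩
    s * s                  ≈⟨ *-congˡ (f-suc n) ⟨
    s * (f n * f (suc n))  ≈⟨ *-assoc s (f n) (f (suc n)) ⟨
    s * f n * f (suc n)    ∎
  ι-g (suc zero) n = trans (ι-h n) (*-congʳ (sym (*-identityˡ (f n))))
  ι-g (suc (suc r)) n = ι-g r n

  ι-W-rec : ∀ k → ι (W (suc (suc k))) + t * ι (W k) ≈ f (suc k) * f (suc k) * ι (W (suc k))
  ι-W-rec k = begin
    ι (W (suc (suc k))) + t * ι (W k)   ≈⟨ ↦-+ refl (↦-* ι-v refl) ⟨
    ι (W (suc (suc k)) D.+ v D.* W k)   ≈⟨ M.⟦⟧-cong (W-rec k) ⟩
    ι (h (suc k) D.* W (suc k))         ≈⟨ ↦-* (ι-h (suc k)) refl ⟩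
    f (suc k) * f (suc k) * ι (W (suc k)) ∎

  ιW*f≈U : ∀ k → ι (W k) * f k ≈ U k
  ιW*f≈U zero = trans (*-congʳ M.0#-homo) (zeroˡ s)
  ιW*f≈U (suc zero) = trans (*-congʳ M.1#-homo) (*-identityˡ 1#)
  ιW*f≈U (suc (suc k)) = U-rec-unique k (begin
    ιW₂ * f₀ + t * U k          ≈⟨ +-congˡ (*-congˡ (ιW*f≈U k)) ⟨
    ιW₂ * f₀ + t * (ιW₀ * f₀)   ≈⟨ solve 4 (λ ιW₂ f₀ t ιW₀ → ιW₂ :* f₀ :+ t :* (ιW₀ :* f₀) := (ιW₂ :+ t :* ιW₀) :* f₀)
                                     refl ιW₂ f₀ t ιW₀ ⟩
    (ιW₂ + t * ιW₀) * f₀        ≈⟨ *-congʳ (ι-W-rec k) ⟩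
    f₁ * f₁ * ιW₁ * f₀          ≈⟨ solve 3 (λ f₁ ιW₁ f₀ → f₁ :* f₁ :* ιW₁ :* f₀ := f₀ :* f₁ :* (ιW₁ :* f₁))
                                     refl f₁ ιW₁ f₀ ⟩
    f₀ * f₁ * (ιW₁ * f₁)        ≈⟨ *-cong (f-suc k) (ιW*f≈U (suc k)) ⟩
    s * U (suc k)               ∎)
    where
    ιW₀ = ι (W k)
    ιW₁ = ι (W (suc k))
    ιW₂ = ι (W (suc (suc k)))
    f₀ = f k
    f₁ = f (suc k)

  ιW≈U-odd : ∀ k → ι (W (suc (2 ℕ.* k))) ≈ U (suc (2 ℕ.* k))
  ιW≈U-odd k = begin
    ι (W m)          ≈⟨ *-identityʳ (ι (W m)) ⟨
    ι (W m) * 1#     ≈⟨ *-congˡ (reflexive (≡.sym (alternate-odd k))) ⟩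
    ι (W m) * f m    ≈⟨ ιW*f≈U m ⟩
    U m              ∎
    where
    m = suc (2 ℕ.* k)

  -- U-+ multiplied by f (r + suc n) * s², which puts each of its terms in the image of ι.
  W-+ : ∀ r n →
    W (r ℕ.+ suc n) D.* (h (r ℕ.+ suc n) D.* u) D.+ v D.* W r D.* W n D.* (g r n D.* u)
      D.≈ W (suc r) D.* W (suc n) D.* (h (suc r) D.* h (suc n) D.* g r n)
  W-+ r n = ↦-injective lhs↦ rhs↦
    where
    N = r ℕ.+ suc n
    e = f N * (s * s)

    first : W N D.* (h N D.* u) ↦ U N * e
    first = trans (↦-* refl (↦-* (ι-h N) ι-u)) (begin
      ι (W N) * (f N * f N * (s * s))  ≈⟨ solve 3 (λ w φ σ → w :* (φ :* φ :* σ) := w :* φ :* (φ :* σ))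
                                              refl (ι (W N)) (f N) (s * s) ⟩
      ι (W N) * f N * e                ≈⟨ *-congʳ (ιW*f≈U N) ⟩
      U N * e                          ∎)

    second : v D.* W r D.* W n D.* (g r n D.* u) ↦ t * U r * U n * e
    second = trans (↦-* (↦-* (↦-* ι-v refl) refl) (↦-* (ι-g r n) ι-u)) (begin
      t * ι (W r) * ι (W n) * (f r * f n * f N * (s * s))
        ≈⟨ solve 7 (λ t wᵣ wₙ φᵣ φₙ φ σ → t :* wᵣ :* wₙ :* (φᵣ :* φₙ :* φ :* σ)
                                          := t :* (wᵣ :* φᵣ) :* (wₙ :* φₙ) :* (φ :* σ))
             refl t (ι (W r)) (ι (W n)) (f r) (f n) (f N) (s * s) ⟩
      t * (ι (W r) * f r) * (ι (W n) * f n) * e  ≈⟨ *-congʳ (*-cong (*-congˡ (ιW*f≈U r)) (ιW*f≈U n)) ⟩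
      t * U r * U n * e                          ∎)

    lhs↦ : W N D.* (h N D.* u) D.+ v D.* W r D.* W n D.* (g r n D.* u) ↦ U (suc r) * U (suc n) * e
    lhs↦ = trans (↦-+ first second) (begin
      U N * e + t * U r * U n * e    ≈⟨ distribʳ e (U N) (t * U r * U n) ⟨
      (U N + t * U r * U n) * e      ≈⟨ *-congʳ (U-+ r n) ⟩
      U (suc r) * U (suc n) * e      ∎)

    rhs↦ : W (suc r) D.* W (suc n) D.* (h (suc r) D.* h (suc n) D.* g r n) ↦ U (suc r) * U (suc n) * e
    rhs↦ = trans (↦-* (↦-* refl refl) (↦-* (↦-* (ι-h (suc r)) (ι-h (suc n))) (ι-g r n))) (begin
      ι (W (suc r)) * ι (W (suc n)) * (f (suc r) * f (suc r) * (f (suc n) * f (suc n)) * (f r * f n * f N))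
        ≈⟨ solve 7 (λ wᵣ wₙ φᵣ φᵣ₁ φₙ φₙ₁ φ → wᵣ :* wₙ :* (φᵣ₁ :* φᵣ₁ :* (φₙ₁ :* φₙ₁) :* (φᵣ :* φₙ :* φ))
                                               := wᵣ :* φᵣ₁ :* (wₙ :* φₙ₁) :* (φ :* (φᵣ :* φᵣ₁ :* (φₙ :* φₙ₁))))
             refl (ι (W (suc r))) (ι (W (suc n))) (f r) (f (suc r)) (f n) (f (suc n)) (f N) ⟩
      ι (W (suc r)) * f (suc r) * (ι (W (suc n)) * f (suc n)) * (f N * (f r * f (suc r) * (f n * f (suc n))))
        ≈⟨ *-cong (*-cong (ιW*f≈U (suc r)) (ιW*f≈U (suc n))) (*-congˡ (*-cong (f-suc r) (f-suc n))) ⟩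
      U (suc r) * U (suc n) * e  ∎)

  module _ {p} (prime : IsPrime D p) where
    open PrimeDivisor prime
    open Prime prime

    ∣g⇒∣u : ∀ r n → p ∣ g r n → p ∣ u
    ∣g⇒∣u r n = alternate-preserves {P = λ x → p ∣ x → p ∣ u} (λ p∣u → p∣u) (∣h⇒∣u n) r

    W-euclid : ¬ p ∣ u → ¬ p ∣ v → ∀ r n → p ∣ W (r ℕ.+ suc n) → p ∣ W (suc n) → p ∣ W r
    W-euclid p∤u p∤v r n p∣W[N] p∣W[1+n] =
      ∣xy∧∤x⇒∣y (∣xy∧∤y⇒∣x (∣xy∧∤y⇒∣x p∣vWWgu p∤gu) p∤W[n]) p∤v
      where
      p∣vWWgu : p ∣ v D.* W r D.* W n D.* (g r n D.* u)
      p∣vWWgu = x∣y+z∧x∣y⇒x∣z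
        (∣-respʳ (D.sym (W-+ r n)) (x∣y⇒x∣yz _ (x∣y⇒x∣zy (W (suc r)) p∣W[1+n])))
        (x∣y⇒x∣yz _ p∣W[N])
      p∤gu : ¬ p ∣ g r n D.* u
      p∤gu = ∤x∧∤y⇒∤xy (λ p∣g → p∤u (∣g⇒∣u r n p∣g)) p∤u
      p∤W[n] : ¬ p ∣ W n
      p∤W[n] p∣W[n] = p∤v (∣W[1+k]∧∣W[k]⇒∣v n p∣W[1+n] p∣W[n])

  W-coprime : CoprimeIn D u v → ∀ k {n} → Coprime (suc (2 ℕ.* k)) n →
              CoprimeIn D (W (suc (2 ℕ.* k))) (W n)
  W-coprime u⊥v k m⊥n p prime p∣W[m] p∣W[n] = prime∤1 (coprime⇒Q1 m⊥n p∣W[m] p∣W[n])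
    where
    open PrimeDivisor prime
    open Prime prime
    p∤v : ¬ p ∣ v
    p∤v p∣v = u⊥v p prime (∣v∧∣W[1+k]⇒∣u (2 ℕ.* k) p∣v p∣W[m]) p∣v
    p∤u : ¬ p ∣ u
    p∤u p∣u = p∤v (∣u∧∣W[1+2k]⇒∣v k p∣u p∣W[m])
    open CoprimeDescent (λ i → p ∣ W i) (W-euclid prime p∤u p∤v)

lemma2p5 : {c ℓ c' ℓ' : Level} (D : CommutativeRing c ℓ) (R : CommutativeRing c' ℓ')
    (ι : CommutativeRing.Carrier D → CommutativeRing.Carrier R) →
    IsUFD D → IsIntegralDomain R → IsRingMonomorphism D R ι →
    (a b : CommutativeRing.Carrier R) →
    IsAlgebraicOver D R ι a → IsAlgebraicOver D R ι b →
    (u v : CommutativeRing.Carrier D) →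
    CommutativeRing._≈_ R (ι u) (CommutativeRing._*_ R (CommutativeRing._+_ R a b) (CommutativeRing._+_ R a b)) →
    CommutativeRing._≈_ R (ι v) (CommutativeRing._*_ R a b) →
    CoprimeIn D u v →
    (m n : ℕ) → m ≥ 1 → n ≥ 1 → Coprime m n → Odd m → Odd n →
    Σ (CommutativeRing.Carrier D) λ p → Σ (CommutativeRing.Carrier D) λ q →
    CommutativeRing._≈_ R (ι p) (P R m a b) × CommutativeRing._≈_ R (ι q) (P R n a b) × CoprimeIn D p q
lemma2p5 D R ι _ _ mono a b _ _ u v ι-u ι-v u⊥v _ _ _ _ m⊥n (k , ≡.refl) (l , ≡.refl) =
  W (suc (2 ℕ.* k)) , W (suc (2 ℕ.* l)) , ιW≈P k , ιW≈P l , W-coprime u⊥v k m⊥n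
  where
  open ReducedLucas D u v using (W)
  open Transfer mono ι-u ι-v using (ιW≈U-odd; W-coprime)
  ιW≈P : ∀ k → CommutativeRing._≈_ R (ι (W (suc (2 ℕ.* k)))) (P R (suc (2 ℕ.* k)) a b)
  ιW≈P k = CommutativeRing.trans R (ιW≈U-odd k) (CommutativeRing.sym R (Homogeneous.P≈U R a b (suc (2 ℕ.* k))))
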